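{- The ordinary generating function, with respect to length, of partial GDAP ending at a point with positive ordinate is $$\frac{\left(x^2-x-1+\sqrt{x^4-2x^3-x^2-2x+1}\right)^2}{4x\sqrt{x^4-2x^3-x^2-2x+1}},$$ where the square root is the formal power series with constant term $1$.
   Context: A grand Dyck path with air pockets (GDAP) is a lattice path in $\mathbb{Z}^2$ starting at $(0,0)$ and ending on the $x$-axis, consisting of up-steps $U=(1,1)$ and down-steps $D_k=(1,-k)$ with $k\ge 1$, such that no two down-steps are consecutive; the path may go below the $x$-axis, and the empty path is a GDAP. A partial GDAP is a prefix (initial segment, possibly the whole path) of a GDAP. The length of a path is its number of steps. -}

module Defs where

open import Data.Nat as ℕ using (ℕ; zero; suc; _∸_)
open import Data.Integer as ℤ using (ℤ; +_; -[1+_])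
open import Data.Rational as ℚ using (ℚ; 0ℚ; 1ℚ)
open import Data.List using (List; []; _∷_; _++_; length; map; foldr; upTo)
open import Data.List.Membership.Propositional using (_∈_)
open import Data.List.Relation.Unary.Unique.Propositional using (Unique)
open import Data.Product using (Σ; ∃; ∃-syntax; _×_; _,_)
open import Data.Unit using (⊤)
open import Data.Empty using (⊥)
open import Function.Bundles using (_⇔_)
open import Relation.Binary.PropositionalEquality using (_≡_)

-- U = (1,1);  D k = (1, -(k+1)), i.e. D k encodes the down-step D_{k+1}
-- so that every down-step has k ≥ 1.
data Step : Set where
  U : Step
  D : ℕ → Step

Path : Set
Path = List Step

stepHeight : Step → ℤ
stepHeight U     = + 1
stepHeight (D k) = -[1+ k ]

height : Path → ℤ
height []       = + 0
height (s ∷ ss) = stepHeight s ℤ.+ height ss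

NoDD : Path → Set
NoDD []                = ⊤
NoDD (U ∷ ss)          = NoDD ss
NoDD (D k ∷ [])        = ⊤
NoDD (D k ∷ U ∷ ss)    = NoDD (U ∷ ss)
NoDD (D k ∷ D j ∷ ss)  = ⊥

IsGDAP : Path → Set
IsGDAP w = NoDD w × height w ≡ + 0

IsPartialGDAP : Path → Set
IsPartialGDAP p = ∃[ w ] IsGDAP (p ++ w)

Counted : ℕ → Path → Set
Counted n p = length p ≡ n × IsPartialGDAP p × (+ 0 ℤ.< height p)

HasCount : ℕ → ℕ → Set
HasCount n k = ∃[ L ] (Unique L × (∀ p → (p ∈ L) ⇔ Counted n p) × length L ≡ k)

Series : Set
Series = ℕ → ℚ

sumℚ : List ℚ → ℚ
sumℚ = foldr ℚ._+_ 0ℚ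

_⊕_ : Series → Series → Series
(f ⊕ g) n = f n ℚ.+ g n

⊖_ : Series → Series
(⊖ f) n = ℚ.- (f n)

_⊛_ : Series → Series → Series
(f ⊛ g) n = sumℚ (map (λ i → f i ℚ.* g (n ∸ i)) (upTo (suc n)))

xs· : Series → Series
xs· f zero    = 0ℚ
xs· f (suc n) = f n

-- polynomial with given coefficient list (constant term first)
poly : List ℚ → Series
poly []       n       = 0ℚ
poly (c ∷ cs) zero    = c
poly (c ∷ cs) (suc n) = poly cs n

q : ℤ → ℚ
q z = z ℚ./ 1

fromℕs : (ℕ → ℕ) → Series
fromℕs a n = q (+ a n)

Pdisc : Series
Pdisc = poly (q (+ 1) ∷ q (ℤ.- (+ 2)) ∷ q (ℤ.- (+ 1)) ∷ q (ℤ.- (+ 2)) ∷ q (+ 1) ∷ [])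

Pquad : Series
Pquad = poly (q (ℤ.- (+ 1)) ∷ q (ℤ.- (+ 1)) ∷ q (+ 1) ∷ [])

IsSqrtDisc : Series → Set
IsSqrtDisc S = S 0 ≡ 1ℚ × (∀ n → (S ⊛ S) n ≡ Pdisc n)

Numer : Series → Series
Numer S = (Pquad ⊕ S) ⊛ (Pquad ⊕ S)

Denom : Series → Series
Denom S = poly (q (+ 4) ∷ []) ⊛ xs· S

{-# OPTIONS --safe #-}

-- A path prefix without DD is a partial GDAP as soon as it ends at positive height (append
-- U D_{m+2} from height m + 1), so we count paths without DD of length n ending at height ≥ 1.
-- Let Q_h count those ending at height ≥ h that do not start with a down-step, and
-- T_h = Σ_{k ≥ 0} Q_{h+k}. Splitting off the first step gives
--   Q_h = [h ≤ 0] + x Q_{h-1} + x² T_h,   T_h = Q_h + T_{h+1},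
-- and T_h has no terms of degree < h; this system determines all Q_h and T_h. The answer is
-- A = Q_1 + x T_2. Let F be the power series root of x F² + (x² - x - 1) F + 1 = 0, i.e.
-- S = -(x² - x - 1) - 2 x F. Then K = (1 - x F²)(1 - x F) times the counting solution is the
-- explicit solution Q_k = (1 - x F) F (x F)^k, T_k = F (x F)^k (k ≥ 0), Q_{-j} = (1 - x F) F^{j+1},
-- so K A = (1 - x F) F · x F + x F (x F)², from which 4 x S · A = (x² - x - 1 + S)² follows
-- after cancelling K, whose constant term is 1.

module Submission where

open import Defs
open import Algebra.Bundles using (CommutativeRing; CommutativeMonoid)
import Algebra.Properties.CommutativeSemigroup as CommSemigroupProperties
import Algebra.Solver.Ring
import Algebra.Solver.Ring.AlmostCommutativeRing as ACR
open import Data.Empty using (⊥; ⊥-elim)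
open import Data.Integer as ℤ using (ℤ; +_; -[1+_])
import Data.Integer.Properties as ℤP
import Data.Integer.Tactic.RingSolver as ℤ-RingSolver
open import Data.List using (List; []; _∷_; _++_; length; map; applyUpTo)
open import Data.List.Membership.Propositional using (_∈_)
open import Data.List.Membership.Propositional.Properties using (∈-map⁺; ∈-map⁻; ∈-++⁺ˡ; ∈-++⁺ʳ; ∈-++⁻)
open import Data.List.Properties using (∷-injectiveʳ; length-++; length-map)
open import Data.List.Relation.Unary.All using ([])
open import Data.List.Relation.Unary.Any using (here)
open import Data.List.Relation.Unary.Unique.Propositional using (Unique; []; _∷_)
import Data.List.Relation.Unary.Unique.Propositional.Properties as Unique
open import Data.Maybe using (Maybe; just; nothing)
open import Data.Nat as ℕ using (ℕ; zero; suc; _∸_; z≤n; s≤s)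
import Data.Nat.Properties as ℕP
open import Data.Product using (∃-syntax; _×_; _,_; proj₁; proj₂)
open import Data.Rational as ℚ using (ℚ; 0ℚ; 1ℚ)
import Data.Rational.Properties as ℚP
import Data.Rational.Unnormalised as ℚᵘ
import Data.Rational.Unnormalised.Properties as ℚᵘP
open import Data.Sum using (inj₁; inj₂)
open import Data.Unit using (⊤; tt)
open import Function using (_∘_; id)
open import Function.Bundles using (_⇔_; mk⇔)
open import Relation.Binary.PropositionalEquality
import Relation.Binary.Reasoning.Setoid
open import Relation.Nullary using (yes; no)
import Tactic.RingSolver as RingSolver
import Tactic.RingSolver.Core.AlmostCommutativeRing as TACR

ℚ-ring : TACR.AlmostCommutativeRing _ _
ℚ-ring = TACR.fromCommutativeRing ℚP.+-*-commutativeRing 0≟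
  where
  0≟ : ∀ x → Maybe (0ℚ ≡ x)
  0≟ x with 0ℚ ℚ.≟ x
  ... | yes e = just e
  ... | no _  = nothing

module ℚ+-Properties = CommSemigroupProperties
  (CommutativeMonoid.commutativeSemigroup ℚP.+-0-commutativeMonoid)

infix 4 _≈_
_≈_ : Series → Series → Set
f ≈ g = ∀ n → f n ≡ g n

tail : Series → Series
tail f n = f (suc n)

map-applyUpTo : ∀ {A B : Set} (h : A → B) (f : ℕ → A) n →
                map h (applyUpTo f n) ≡ applyUpTo (h ∘ f) n
map-applyUpTo h f zero    = refl
map-applyUpTo h f (suc n) = cong (h (f 0) ∷_) (map-applyUpTo h (f ∘ suc) n)

⊛-head : ∀ f g → (f ⊛ g) 0 ≡ f 0 ℚ.* g 0
⊛-head f g = ℚP.+-identityʳ _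

⊛-suc : ∀ f g n → (f ⊛ g) (suc n) ≡ f 0 ℚ.* g (suc n) ℚ.+ (tail f ⊛ g) n
⊛-suc f g n = cong (λ l → f 0 ℚ.* g (suc n) ℚ.+ sumℚ l) (begin
  map (λ i → f i ℚ.* g (suc n ∸ i)) (applyUpTo suc (suc n))  ≡⟨ map-applyUpTo _ suc (suc n) ⟩
  applyUpTo (λ i → f (suc i) ℚ.* g (n ∸ i)) (suc n)            ≡⟨ map-applyUpTo _ id (suc n) ⟨
  map (λ i → f (suc i) ℚ.* g (n ∸ i)) (applyUpTo id (suc n))   ∎)
  where open ≡-Reasoning

0ₛ 1ₛ : Series
0ₛ _ = 0ℚ
1ₛ = poly (1ℚ ∷ [])

⊛-cong : ∀ {f f′ g g′} → f ≈ f′ → g ≈ g′ → f ⊛ g ≈ f′ ⊛ g′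
⊛-cong {f} {f′} {g} {g′} f≈ g≈ zero = begin
  (f ⊛ g) 0       ≡⟨ ⊛-head f g ⟩
  f 0 ℚ.* g 0     ≡⟨ cong₂ ℚ._*_ (f≈ 0) (g≈ 0) ⟩
  f′ 0 ℚ.* g′ 0   ≡⟨ ⊛-head f′ g′ ⟨
  (f′ ⊛ g′) 0     ∎
  where open ≡-Reasoning
⊛-cong {f} {f′} {g} {g′} f≈ g≈ (suc n) = begin
  (f ⊛ g) (suc n)                                ≡⟨ ⊛-suc f g n ⟩
  f 0 ℚ.* g (suc n) ℚ.+ (tail f ⊛ g) n           ≡⟨ cong₂ ℚ._+_ (cong₂ ℚ._*_ (f≈ 0) (g≈ (suc n)))
                                                       (⊛-cong {tail f} {tail f′} (f≈ ∘ suc) g≈ n) ⟩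
  f′ 0 ℚ.* g′ (suc n) ℚ.+ (tail f′ ⊛ g′) n       ≡⟨ ⊛-suc f′ g′ n ⟨
  (f′ ⊛ g′) (suc n)                              ∎
  where open ≡-Reasoning

⊛-vanishes : ∀ f g n → (∀ m → m ℕ.≤ n → f m ≡ 0ℚ) → (f ⊛ g) n ≡ 0ℚ
⊛-vanishes f g zero f≡0 = begin
  (f ⊛ g) 0     ≡⟨ ⊛-head f g ⟩
  f 0 ℚ.* g 0   ≡⟨ cong (ℚ._* g 0) (f≡0 0 z≤n) ⟩
  0ℚ ℚ.* g 0    ≡⟨ ℚP.*-zeroˡ (g 0) ⟩
  0ℚ            ∎
  where open ≡-Reasoning
⊛-vanishes f g (suc n) f≡0 = begin
  (f ⊛ g) (suc n)                         ≡⟨ ⊛-suc f g n ⟩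
  f 0 ℚ.* g (suc n) ℚ.+ (tail f ⊛ g) n    ≡⟨ cong₂ ℚ._+_ (cong (ℚ._* g (suc n)) (f≡0 0 z≤n))
                                                (⊛-vanishes (tail f) g n (λ m m≤n → f≡0 (suc m) (s≤s m≤n))) ⟩
  0ℚ ℚ.* g (suc n) ℚ.+ 0ℚ                  ≡⟨ cong (ℚ._+ 0ℚ) (ℚP.*-zeroˡ (g (suc n))) ⟩
  0ℚ ℚ.+ 0ℚ                               ≡⟨ ℚP.+-identityʳ 0ℚ ⟩
  0ℚ                                      ∎
  where open ≡-Reasoning

⊛-zeroˡ : ∀ f → 0ₛ ⊛ f ≈ 0ₛ
⊛-zeroˡ f n = ⊛-vanishes 0ₛ f n (λ _ _ → refl)

⊛-identityˡ : ∀ f → 1ₛ ⊛ f ≈ f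
⊛-identityˡ f zero    = trans (⊛-head 1ₛ f) (ℚP.*-identityˡ (f 0))
⊛-identityˡ f (suc n) = begin
  (1ₛ ⊛ f) (suc n)                             ≡⟨ ⊛-suc 1ₛ f n ⟩
  1ℚ ℚ.* f (suc n) ℚ.+ (0ₛ ⊛ f) n              ≡⟨ cong₂ ℚ._+_ (ℚP.*-identityˡ (f (suc n))) (⊛-zeroˡ f n) ⟩
  f (suc n) ℚ.+ 0ℚ                             ≡⟨ ℚP.+-identityʳ _ ⟩
  f (suc n)                                    ∎
  where open ≡-Reasoning

⊛-distribʳ : ∀ h f g → (f ⊕ g) ⊛ h ≈ (f ⊛ h) ⊕ (g ⊛ h)
⊛-distribʳ h f g zero = begin
  ((f ⊕ g) ⊛ h) 0                   ≡⟨ ⊛-head (f ⊕ g) h ⟩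
  (f 0 ℚ.+ g 0) ℚ.* h 0             ≡⟨ ℚP.*-distribʳ-+ (h 0) (f 0) (g 0) ⟩
  f 0 ℚ.* h 0 ℚ.+ g 0 ℚ.* h 0       ≡⟨ cong₂ ℚ._+_ (⊛-head f h) (⊛-head g h) ⟨
  (f ⊛ h) 0 ℚ.+ (g ⊛ h) 0           ∎
  where open ≡-Reasoning
⊛-distribʳ h f g (suc n) = begin
  ((f ⊕ g) ⊛ h) (suc n)                                        ≡⟨ ⊛-suc (f ⊕ g) h n ⟩
  (f 0 ℚ.+ g 0) ℚ.* h (suc n) ℚ.+ ((tail f ⊕ tail g) ⊛ h) n     ≡⟨ cong₂ ℚ._+_ (ℚP.*-distribʳ-+ (h (suc n)) (f 0) (g 0))
                                                                      (⊛-distribʳ h (tail f) (tail g) n) ⟩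
  (f 0 ℚ.* h (suc n) ℚ.+ g 0 ℚ.* h (suc n))
    ℚ.+ ((tail f ⊛ h) n ℚ.+ (tail g ⊛ h) n)                     ≡⟨ interchange (f 0 ℚ.* h (suc n)) (g 0 ℚ.* h (suc n)) _ _ ⟩
  (f 0 ℚ.* h (suc n) ℚ.+ (tail f ⊛ h) n)
    ℚ.+ (g 0 ℚ.* h (suc n) ℚ.+ (tail g ⊛ h) n)                  ≡⟨ cong₂ ℚ._+_ (⊛-suc f h n) (⊛-suc g h n) ⟨
  (f ⊛ h) (suc n) ℚ.+ (g ⊛ h) (suc n)                          ∎
  where open ≡-Reasoning; open ℚ+-Properties using (interchange)

⊛-comm : ∀ f g → f ⊛ g ≈ g ⊛ f
⊛-comm f g zero = begin
  (f ⊛ g) 0      ≡⟨ ⊛-head f g ⟩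
  f 0 ℚ.* g 0    ≡⟨ ℚP.*-comm (f 0) (g 0) ⟩
  g 0 ℚ.* f 0    ≡⟨ ⊛-head g f ⟨
  (g ⊛ f) 0      ∎
  where open ≡-Reasoning
⊛-comm f g (suc zero) = begin
  (f ⊛ g) 1                         ≡⟨ expand f g ⟩
  f 0 ℚ.* g 1 ℚ.+ f 1 ℚ.* g 0       ≡⟨ cong₂ ℚ._+_ (ℚP.*-comm (f 0) (g 1)) (ℚP.*-comm (f 1) (g 0)) ⟩
  g 1 ℚ.* f 0 ℚ.+ g 0 ℚ.* f 1       ≡⟨ ℚP.+-comm (g 1 ℚ.* f 0) (g 0 ℚ.* f 1) ⟩
  g 0 ℚ.* f 1 ℚ.+ g 1 ℚ.* f 0       ≡⟨ expand g f ⟨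
  (g ⊛ f) 1                         ∎
  where
  open ≡-Reasoning
  expand : ∀ f g → (f ⊛ g) 1 ≡ f 0 ℚ.* g 1 ℚ.+ f 1 ℚ.* g 0
  expand f g = trans (⊛-suc f g 0) (cong (f 0 ℚ.* g 1 ℚ.+_) (⊛-head (tail f) g))
⊛-comm f g (suc (suc m)) = begin
  (f ⊛ g) (2 ℕ.+ m)                                ≡⟨ expand f g (⊛-comm (tail f) g (suc m)) ⟩
  a ℚ.+ (b ℚ.+ (tail g ⊛ tail f) m)                ≡⟨ cong (λ t → a ℚ.+ (b ℚ.+ t)) (⊛-comm (tail g) (tail f) m) ⟩
  a ℚ.+ (b ℚ.+ (tail f ⊛ tail g) m)                ≡⟨ x∙yz≈y∙xz a b _ ⟩
  b ℚ.+ (a ℚ.+ (tail f ⊛ tail g) m)                ≡⟨ expand g f (⊛-comm (tail g) f (suc m)) ⟨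
  (g ⊛ f) (2 ℕ.+ m)                                ∎
  where
  open ≡-Reasoning; open ℚ+-Properties using (x∙yz≈y∙xz)
  a = f 0 ℚ.* g (2 ℕ.+ m)
  b = g 0 ℚ.* f (2 ℕ.+ m)
  expand : ∀ f g → (tail f ⊛ g) (suc m) ≡ (g ⊛ tail f) (suc m) →
           (f ⊛ g) (2 ℕ.+ m) ≡ f 0 ℚ.* g (2 ℕ.+ m) ℚ.+ (g 0 ℚ.* f (2 ℕ.+ m) ℚ.+ (tail g ⊛ tail f) m)
  expand f g comm = trans (⊛-suc f g (suc m)) (cong (f 0 ℚ.* g (2 ℕ.+ m) ℚ.+_) (trans comm (⊛-suc g (tail f) m)))

infixr 7 _·ₛ_
_·ₛ_ : ℚ → Series → Series
(c ·ₛ f) n = c ℚ.* f n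

·ₛ-identityˡ : ∀ f → 1ℚ ·ₛ f ≈ f
·ₛ-identityˡ f n = ℚP.*-identityˡ (f n)

·ₛ-zeroˡ : ∀ f → 0ℚ ·ₛ f ≈ 0ₛ
·ₛ-zeroˡ f n = ℚP.*-zeroˡ (f n)

·ₛ-⊛ : ∀ c f g → (c ·ₛ f) ⊛ g ≈ c ·ₛ (f ⊛ g)
·ₛ-⊛ c f g zero = begin
  ((c ·ₛ f) ⊛ g) 0       ≡⟨ ⊛-head (c ·ₛ f) g ⟩
  c ℚ.* f 0 ℚ.* g 0      ≡⟨ ℚP.*-assoc c (f 0) (g 0) ⟩
  c ℚ.* (f 0 ℚ.* g 0)    ≡⟨ cong (c ℚ.*_) (⊛-head f g) ⟨
  c ℚ.* (f ⊛ g) 0        ∎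
  where open ≡-Reasoning
·ₛ-⊛ c f g (suc n) = begin
  ((c ·ₛ f) ⊛ g) (suc n)                                  ≡⟨ ⊛-suc (c ·ₛ f) g n ⟩
  c ℚ.* f 0 ℚ.* g (suc n) ℚ.+ ((c ·ₛ tail f) ⊛ g) n        ≡⟨ cong₂ ℚ._+_ (ℚP.*-assoc c (f 0) (g (suc n))) (·ₛ-⊛ c (tail f) g n) ⟩
  c ℚ.* (f 0 ℚ.* g (suc n)) ℚ.+ c ℚ.* (tail f ⊛ g) n       ≡⟨ ℚP.*-distribˡ-+ c (f 0 ℚ.* g (suc n)) ((tail f ⊛ g) n) ⟨
  c ℚ.* (f 0 ℚ.* g (suc n) ℚ.+ (tail f ⊛ g) n)             ≡⟨ cong (c ℚ.*_) (⊛-suc f g n) ⟨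
  c ℚ.* (f ⊛ g) (suc n)                                   ∎
  where open ≡-Reasoning

⊛-assoc : ∀ f g h → (f ⊛ g) ⊛ h ≈ f ⊛ (g ⊛ h)
⊛-assoc f g h zero = begin
  ((f ⊛ g) ⊛ h) 0          ≡⟨ ⊛-head (f ⊛ g) h ⟩
  (f ⊛ g) 0 ℚ.* h 0        ≡⟨ cong (ℚ._* h 0) (⊛-head f g) ⟩
  f 0 ℚ.* g 0 ℚ.* h 0      ≡⟨ ℚP.*-assoc (f 0) (g 0) (h 0) ⟩
  f 0 ℚ.* (g 0 ℚ.* h 0)    ≡⟨ cong (f 0 ℚ.*_) (⊛-head g h) ⟨
  f 0 ℚ.* (g ⊛ h) 0        ≡⟨ ⊛-head f (g ⊛ h) ⟨
  (f ⊛ (g ⊛ h)) 0          ∎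
  where open ≡-Reasoning
⊛-assoc f g h (suc n) = begin
  ((f ⊛ g) ⊛ h) (suc n)                                        ≡⟨ ⊛-suc (f ⊛ g) h n ⟩
  (f ⊛ g) 0 ℚ.* h (suc n) ℚ.+ (tail (f ⊛ g) ⊛ h) n             ≡⟨ cong₂ ℚ._+_ (cong (ℚ._* h (suc n)) (⊛-head f g)) tail-step ⟩
  f 0 ℚ.* g 0 ℚ.* h (suc n) ℚ.+ (f 0 ℚ.* (tail g ⊛ h) n ℚ.+ (tail f ⊛ (g ⊛ h)) n)
                                                               ≡⟨ regroup (f 0) (g 0) (h (suc n)) _ _ ⟩
  f 0 ℚ.* (g 0 ℚ.* h (suc n) ℚ.+ (tail g ⊛ h) n) ℚ.+ (tail f ⊛ (g ⊛ h)) n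
                                                               ≡⟨ cong (λ t → f 0 ℚ.* t ℚ.+ (tail f ⊛ (g ⊛ h)) n) (⊛-suc g h n) ⟨
  f 0 ℚ.* (g ⊛ h) (suc n) ℚ.+ (tail f ⊛ (g ⊛ h)) n             ≡⟨ ⊛-suc f (g ⊛ h) n ⟨
  (f ⊛ (g ⊛ h)) (suc n)                                        ∎
  where
  open ≡-Reasoning
  regroup : ∀ a b c d e → a ℚ.* b ℚ.* c ℚ.+ (a ℚ.* d ℚ.+ e) ≡ a ℚ.* (b ℚ.* c ℚ.+ d) ℚ.+ e
  regroup = RingSolver.solve-∀ ℚ-ring
  tail-step : (tail (f ⊛ g) ⊛ h) n ≡ f 0 ℚ.* (tail g ⊛ h) n ℚ.+ (tail f ⊛ (g ⊛ h)) n
  tail-step = begin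
    (tail (f ⊛ g) ⊛ h) n                          ≡⟨ ⊛-cong {tail (f ⊛ g)} {(f 0 ·ₛ tail g) ⊕ (tail f ⊛ g)} {h} {h} (⊛-suc f g) (λ _ → refl) n ⟩
    (((f 0 ·ₛ tail g) ⊕ (tail f ⊛ g)) ⊛ h) n       ≡⟨ ⊛-distribʳ h (f 0 ·ₛ tail g) (tail f ⊛ g) n ⟩
    ((f 0 ·ₛ tail g) ⊛ h) n ℚ.+ ((tail f ⊛ g) ⊛ h) n ≡⟨ cong₂ ℚ._+_ (·ₛ-⊛ (f 0) (tail g) h n) (⊛-assoc (tail f) g h n) ⟩
    f 0 ℚ.* (tail g ⊛ h) n ℚ.+ (tail f ⊛ (g ⊛ h)) n ∎

𝕊 : CommutativeRing _ _
𝕊 = record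
  { Carrier = Series ; _≈_ = _≈_ ; _+_ = _⊕_ ; _*_ = _⊛_ ; -_ = ⊖_ ; 0# = 0ₛ ; 1# = 1ₛ
  ; isCommutativeRing = record
    { isRing = record
      { +-isAbelianGroup = record
        { isGroup = record
          { isMonoid = record
            { isSemigroup = record
              { isMagma = record
                { isEquivalence = record { refl = λ _ → refl ; sym = λ e n → sym (e n) ; trans = λ e e′ n → trans (e n) (e′ n) }
                ; ∙-cong = λ e e′ n → cong₂ ℚ._+_ (e n) (e′ n) }
              ; assoc = λ f g h n → ℚP.+-assoc (f n) (g n) (h n) }
            ; identity = (λ f n → ℚP.+-identityˡ (f n)) , (λ f n → ℚP.+-identityʳ (f n)) }
          ; inverse = (λ f n → ℚP.+-inverseˡ (f n)) , (λ f n → ℚP.+-inverseʳ (f n))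
          ; ⁻¹-cong = λ e n → cong ℚ.-_ (e n) }
        ; comm = λ f g n → ℚP.+-comm (f n) (g n) }
      ; *-cong = λ {f} {f′} {g} {g′} → ⊛-cong {f} {f′} {g} {g′}
      ; *-assoc = ⊛-assoc
      ; *-identity = ⊛-identityˡ , λ f n → trans (⊛-comm f 1ₛ n) (⊛-identityˡ f n)
      ; distrib = (λ f g h n → trans (⊛-comm f (g ⊕ h) n)
                                 (trans (⊛-distribʳ f g h n) (cong₂ ℚ._+_ (⊛-comm g f n) (⊛-comm h f n))))
                , ⊛-distribʳ }
    ; *-comm = ⊛-comm } }

const : ℚ → Series
const c = poly (c ∷ [])

const-⊛ : ∀ c f → const c ⊛ f ≈ c ·ₛ f
const-⊛ c f zero    = ⊛-head (const c) f
const-⊛ c f (suc n) = begin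
  (const c ⊛ f) (suc n)                   ≡⟨ ⊛-suc (const c) f n ⟩
  c ℚ.* f (suc n) ℚ.+ (0ₛ ⊛ f) n          ≡⟨ cong (c ℚ.* f (suc n) ℚ.+_) (⊛-zeroˡ f n) ⟩
  c ℚ.* f (suc n) ℚ.+ 0ℚ                  ≡⟨ ℚP.+-identityʳ _ ⟩
  c ℚ.* f (suc n)                         ∎
  where open ≡-Reasoning

const-homomorphism : CommutativeRing.rawRing ℚP.+-*-commutativeRing ACR.-Raw-AlmostCommutative⟶ ACR.fromCommutativeRing 𝕊
const-homomorphism = record
  { ⟦_⟧    = const
  ; +-homo = λ { a b zero → refl ; a b (suc n) → sym (ℚP.+-identityʳ 0ℚ) }
  ; *-homo = λ { a b zero → sym (const-⊛ a (const b) 0) ; a b (suc n) → sym (trans (const-⊛ a (const b) (suc n)) (ℚP.*-zeroʳ a)) }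
  ; -‿homo = λ { a zero → refl ; a (suc n) → refl }
  ; 0-homo = λ { zero → refl ; (suc n) → refl }
  ; 1-homo = λ { zero → refl ; (suc n) → refl }
  }

const-≟ : ∀ a b → Maybe (const a ≈ const b)
const-≟ a b with a ℚ.≟ b
... | yes refl = just (λ _ → refl)
... | no _     = nothing

open Algebra.Solver.Ring _ (ACR.fromCommutativeRing 𝕊) const-homomorphism const-≟
  using (solve; _:=_; _:+_; _:*_; :-_; _:-_; con)

open CommutativeRing 𝕊
  using (_+_; _*_; -_; _-_; +-cong; *-cong; -‿cong; +-identityˡ; +-identityʳ; zeroʳ; distribˡ; +-group)
  renaming (refl to ≈-refl; trans to ≈-trans)
open import Algebra.Properties.Group +-group using (x∙y⁻¹≈ε⇒x≈y; x≈y⇒x∙y⁻¹≈ε)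

module ≈-Reasoning = Relation.Binary.Reasoning.Setoid (CommutativeRing.setoid 𝕊)

⊛≈0⇒≈0 : ∀ {k} → k 0 ≡ 1ℚ → ∀ d → d * k ≈ 0ₛ → d ≈ 0ₛ
⊛≈0⇒≈0 {k} k₀≡1 d dk≈0 zero = begin
  d 0                ≡⟨ ℚP.*-identityʳ (d 0) ⟨
  d 0 ℚ.* 1ℚ         ≡⟨ cong (d 0 ℚ.*_) k₀≡1 ⟨
  d 0 ℚ.* k 0        ≡⟨ ⊛-head d k ⟨
  (d ⊛ k) 0          ≡⟨ dk≈0 0 ⟩
  0ℚ                 ∎
  where open ≡-Reasoning
⊛≈0⇒≈0 {k} k₀≡1 d dk≈0 (suc n) = ⊛≈0⇒≈0 k₀≡1 (tail d) tail-dk≈0 n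
  where
  open ≡-Reasoning
  tail-dk≈0 : tail d * k ≈ 0ₛ
  tail-dk≈0 m = begin
    (tail d ⊛ k) m                            ≡⟨ ℚP.+-identityˡ _ ⟨
    0ℚ ℚ.+ (tail d ⊛ k) m                     ≡⟨ cong (ℚ._+ (tail d ⊛ k) m) (ℚP.*-zeroˡ (k (suc m))) ⟨
    0ℚ ℚ.* k (suc m) ℚ.+ (tail d ⊛ k) m       ≡⟨ cong (λ t → t ℚ.* k (suc m) ℚ.+ (tail d ⊛ k) m) (⊛≈0⇒≈0 k₀≡1 d dk≈0 0) ⟨
    d 0 ℚ.* k (suc m) ℚ.+ (tail d ⊛ k) m      ≡⟨ ⊛-suc d k m ⟨
    (d ⊛ k) (suc m)                           ≡⟨ dk≈0 (suc m) ⟩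
    0ℚ                                        ∎

⊛-cancelˡ : ∀ {k} → k 0 ≡ 1ℚ → ∀ a b → k * a ≈ k * b → a ≈ b
⊛-cancelˡ {k} k₀≡1 a b ka≈kb = x∙y⁻¹≈ε⇒x≈y a b (⊛≈0⇒≈0 k₀≡1 (a - b) (≈-trans (factor k a b) (x≈y⇒x∙y⁻¹≈ε ka≈kb)))
  where
  factor : ∀ k a b → (a - b) * k ≈ k * a - k * b
  factor = solve 3 (λ k a b → (a :- b) :* k := k :* a :- k :* b) (λ _ → refl)

X : Series
X = xs· 1ₛ

xs·-cong : ∀ {f g} → f ≈ g → xs· f ≈ xs· g
xs·-cong f≈g zero    = refl
xs·-cong f≈g (suc n) = f≈g n

xs·-⊛ : ∀ f g → xs· f * g ≈ xs· (f * g)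
xs·-⊛ f g zero    = trans (⊛-head (xs· f) g) (ℚP.*-zeroˡ (g 0))
xs·-⊛ f g (suc n) = trans (⊛-suc (xs· f) g n) (trans (cong (ℚ._+ (f ⊛ g) n) (ℚP.*-zeroˡ (g (suc n)))) (ℚP.+-identityˡ _))

xs·≈X* : ∀ f → xs· f ≈ X * f
xs·≈X* f n = sym (trans (xs·-⊛ 1ₛ f n) (xs·-cong (⊛-identityˡ f) n))

i+suc[j]≡suc[i]+j : ∀ i j → i ℤ.+ ℤ.suc j ≡ ℤ.suc i ℤ.+ j
i+suc[j]≡suc[i]+j = shift
  where
  shift : ∀ i j → i ℤ.+ (+ 1 ℤ.+ j) ≡ (+ 1 ℤ.+ i) ℤ.+ j
  shift = ℤ-RingSolver.solve-∀

pred≤⇒≤suc : ∀ {h x} → ℤ.pred h ℤ.≤ x → h ℤ.≤ ℤ.suc x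
pred≤⇒≤suc {h} le = subst (ℤ._≤ _) (ℤP.suc-pred h) (ℤP.suc-mono le)

≤suc⇒pred≤ : ∀ {h x} → h ℤ.≤ ℤ.suc x → ℤ.pred h ℤ.≤ x
≤suc⇒pred≤ {h} {x} le = subst (ℤ.pred h ℤ.≤_) (ℤP.pred-suc x) (ℤP.pred-mono le)

≤-D⁺ : ∀ {h} i {y} → ℤ.suc h ℤ.+ + i ℤ.≤ y → h ℤ.≤ -[1+ i ] ℤ.+ y
≤-D⁺ {h} i {y} le = subst₂ ℤ._≤_ (cancel h (+ i)) (ℤP.+-comm y -[1+ i ]) (ℤP.+-monoˡ-≤ -[1+ i ] le)
  where
  cancel : ∀ h j → ((+ 1 ℤ.+ h) ℤ.+ j) ℤ.+ ℤ.- (+ 1 ℤ.+ j) ≡ h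
  cancel = ℤ-RingSolver.solve-∀

≤-D⁻ : ∀ {h} i {y} → h ℤ.≤ -[1+ i ] ℤ.+ y → ℤ.suc h ℤ.+ + i ℤ.≤ y
≤-D⁻ {h} i {y} le = subst₂ ℤ._≤_ (i+suc[j]≡suc[i]+j h (+ i)) (cancel (+ i) y) (ℤP.+-monoˡ-≤ (+ suc i) le)
  where
  cancel : ∀ j y → (ℤ.- (+ 1 ℤ.+ j) ℤ.+ y) ℤ.+ (+ 1 ℤ.+ j) ≡ y
  cancel = ℤ-RingSolver.solve-∀

height≤length : ∀ p → height p ℤ.≤ + length p
height≤length []        = ℤP.≤-refl
height≤length (U ∷ p)   = ℤP.suc-mono (height≤length p)
height≤length (D k ∷ p) = begin
  -[1+ k ] ℤ.+ height p   ≤⟨ ℤP.+-monoˡ-≤ (height p) ℤ.-≤+ ⟩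
  + 0 ℤ.+ height p        ≡⟨ ℤP.+-identityˡ (height p) ⟩
  height p                ≤⟨ height≤length p ⟩
  + length p              ≤⟨ ℤP.i≤suc[i] (+ length p) ⟩
  + suc (length p)        ∎
  where open ℤP.≤-Reasoning

NoLeadingDown : Path → Set
NoLeadingDown (D _ ∷ _) = ⊥
NoLeadingDown _         = ⊤

Admissible : ℕ → ℤ → Path → Set
Admissible n h p = length p ≡ n × NoDD p × h ℤ.≤ height p

-- downPathsFrom tries the leading down-steps D k for k < fuel n m only; by fuel-bound no
-- larger k leaves room to climb back to height m + k within n steps.
fuel : ℕ → ℤ → ℕ
fuel n m = suc (n ℕ.+ ℤ.∣ m ∣)

upPaths admissiblePaths downPaths : ℕ → ℤ → List Path
downPathsFrom : ℕ → ℤ → ℕ → ℕ → List Path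

upPaths zero (+ zero)  = [] ∷ []
upPaths zero (+ suc _) = []
upPaths zero -[1+ _ ]  = [] ∷ []
upPaths (suc n) h      = map (U ∷_) (admissiblePaths n (ℤ.pred h))

admissiblePaths n h = upPaths n h ++ downPaths n h

downPaths zero    h = []
downPaths (suc n) h = downPathsFrom n (ℤ.suc h) (fuel n (ℤ.suc h)) 0

downPathsFrom n m zero    k = []
downPathsFrom n m (suc f) k = map (D k ∷_) (upPaths n (m ℤ.+ + k)) ++ downPathsFrom n m f (suc k)

fuel-bound : ∀ m i n → m ℤ.+ + i ℤ.≤ + n → i ℕ.< fuel n m
fuel-bound m i n le = s≤s (ℤP.drop‿+≤+ (ℤP.≤-trans i≤n-m (ℤP.+-monoʳ-≤ (+ n) (-i≤∣i∣ m))))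
  where
  cancel : ∀ m i → m ℤ.+ i ℤ.- m ≡ i
  cancel = ℤ-RingSolver.solve-∀
  i≤n-m : + i ℤ.≤ + n ℤ.- m
  i≤n-m = subst (ℤ._≤ + n ℤ.- m) (cancel m (+ i)) (ℤP.+-monoˡ-≤ (ℤ.- m) le)
  -i≤∣i∣ : ∀ i → ℤ.- i ℤ.≤ + ℤ.∣ i ∣
  -i≤∣i∣ (+ _)    = ℤP.neg-≤-pos
  -i≤∣i∣ -[1+ _ ] = ℤP.≤-refl

NoDD-D⁺ : ∀ k r → NoLeadingDown r → NoDD r → NoDD (D k ∷ r)
NoDD-D⁺ k []        _ _  = tt
NoDD-D⁺ k (U ∷ r)   _ nd = nd

NoDD-D⁻ : ∀ k r → NoDD (D k ∷ r) → NoLeadingDown r × NoDD r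
NoDD-D⁻ k []      _  = tt , tt
NoDD-D⁻ k (U ∷ r) nd = tt , nd

admissible-D⁺ : ∀ {n h} i r → Admissible n (ℤ.suc h ℤ.+ + i) r → NoLeadingDown r → Admissible (suc n) h (D i ∷ r)
admissible-D⁺ i r (len , nd , le) up = cong suc len , NoDD-D⁺ i r up nd , ≤-D⁺ i le

admissible-D⁻ : ∀ {n h} i r → Admissible (suc n) h (D i ∷ r) → Admissible n (ℤ.suc h ℤ.+ + i) r × NoLeadingDown r
admissible-D⁻ i r (len , nd , le) with NoDD-D⁻ i r nd
... | up , ndr = (ℕP.suc-injective len , ndr , ≤-D⁻ i le) , up

downPathsFrom-sound : ∀ n m f k p → p ∈ downPathsFrom n m f k →
                      ∃[ i ] ∃[ r ] (p ≡ D i ∷ r × r ∈ upPaths n (m ℤ.+ + i) × k ℕ.≤ i)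
downPathsFrom-sound n m (suc f) k p p∈ with ∈-++⁻ (map (D k ∷_) (upPaths n (m ℤ.+ + k))) p∈
... | inj₁ p∈here with ∈-map⁻ (D k ∷_) p∈here
...   | r , r∈ , refl = k , r , refl , r∈ , ℕP.≤-refl
downPathsFrom-sound n m (suc f) k p p∈ | inj₂ p∈rest with downPathsFrom-sound n m f (suc k) p p∈rest
... | i , r , refl , r∈ , k<i = i , r , refl , r∈ , ℕP.<⇒≤ k<i

upPaths-sound : ∀ n h p → p ∈ upPaths n h → Admissible n h p × NoLeadingDown p
admissiblePaths-sound : ∀ n h p → p ∈ admissiblePaths n h → Admissible n h p
downPaths-sound : ∀ n h p → p ∈ downPaths n h → Admissible n h p

upPaths-sound zero (+ zero) .[] (here refl) = (refl , tt , ℤP.≤-refl) , tt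
upPaths-sound zero -[1+ _ ] .[] (here refl) = (refl , tt , ℤ.-≤+) , tt
upPaths-sound (suc n) h p p∈ with ∈-map⁻ (U ∷_) p∈
... | r , r∈ , refl with admissiblePaths-sound n (ℤ.pred h) r r∈
...   | len , nd , le = (cong suc len , nd , pred≤⇒≤suc le) , tt

admissiblePaths-sound n h p p∈ with ∈-++⁻ (upPaths n h) p∈
... | inj₁ p∈up   = proj₁ (upPaths-sound n h p p∈up)
... | inj₂ p∈down = downPaths-sound n h p p∈down

downPaths-sound (suc n) h p p∈ with downPathsFrom-sound n (ℤ.suc h) (fuel n (ℤ.suc h)) 0 p p∈
... | i , r , refl , r∈ , _ with upPaths-sound n (ℤ.suc h ℤ.+ + i) r r∈
...   | adm , up = admissible-D⁺ i r adm up

downPathsFrom-complete : ∀ n m f k i r → k ℕ.≤ i → i ℕ.< k ℕ.+ f → r ∈ upPaths n (m ℤ.+ + i) →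
                         D i ∷ r ∈ downPathsFrom n m f k
downPathsFrom-complete n m zero k i r k≤i i<k+0 r∈ =
  ⊥-elim (ℕP.<-irrefl refl (ℕP.≤-<-trans k≤i (subst (i ℕ.<_) (ℕP.+-identityʳ k) i<k+0)))
downPathsFrom-complete n m (suc f) k i r k≤i i<k+f r∈ with k ℕP.≟ i
... | yes refl = ∈-++⁺ˡ (∈-map⁺ (D k ∷_) r∈)
... | no k≢i   = ∈-++⁺ʳ (map (D k ∷_) (upPaths n (m ℤ.+ + k)))
                   (downPathsFrom-complete n m f (suc k) i r (ℕP.≤∧≢⇒< k≤i k≢i) (subst (i ℕ.<_) (ℕP.+-suc k f) i<k+f) r∈)

upPaths-complete : ∀ n h p → Admissible n h p → NoLeadingDown p → p ∈ upPaths n h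
admissiblePaths-complete : ∀ n h p → Admissible n h p → p ∈ admissiblePaths n h
downPaths-complete : ∀ n h k r → Admissible n h (D k ∷ r) → D k ∷ r ∈ downPaths n h

upPaths-complete zero (+ zero)  [] _                       _ = here refl
upPaths-complete zero (+ suc _) [] (_ , _ , ℤ.+≤+ ())      _
upPaths-complete zero -[1+ _ ]  [] _                       _ = here refl
upPaths-complete (suc n) h (U ∷ p) (len , nd , le) _ =
  ∈-map⁺ (U ∷_) (admissiblePaths-complete n (ℤ.pred h) p (ℕP.suc-injective len , nd , ≤suc⇒pred≤ le))

admissiblePaths-complete n h []        adm = ∈-++⁺ˡ (upPaths-complete n h [] adm tt)
admissiblePaths-complete n h (U ∷ p)   adm = ∈-++⁺ˡ (upPaths-complete n h (U ∷ p) adm tt)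
admissiblePaths-complete n h (D k ∷ p) adm = ∈-++⁺ʳ (upPaths n h) (downPaths-complete n h k p adm)

downPaths-complete (suc n) h k r adm with admissible-D⁻ k r adm
... | adm′@(len , _ , le) , up = downPathsFrom-complete n (ℤ.suc h) (fuel n (ℤ.suc h)) 0 k r z≤n
  (fuel-bound (ℤ.suc h) k n (ℤP.≤-trans le (subst (λ l → height r ℤ.≤ + l) len (height≤length r))))
  (upPaths-complete n (ℤ.suc h ℤ.+ + k) r adm′ up)

downPaths-leadingDown : ∀ n h p → p ∈ downPaths n h → NoLeadingDown p → ⊥
downPaths-leadingDown (suc n) h p p∈ with downPathsFrom-sound n (ℤ.suc h) (fuel n (ℤ.suc h)) 0 p p∈
... | _ , _ , refl , _ = λ ()

downPathsFrom-unique : ∀ n m f k → Unique (downPathsFrom n m f k)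
upPaths-unique : ∀ n h → Unique (upPaths n h)
admissiblePaths-unique : ∀ n h → Unique (admissiblePaths n h)
downPaths-unique : ∀ n h → Unique (downPaths n h)

downPathsFrom-unique n m zero    k = []
downPathsFrom-unique n m (suc f) k =
  Unique.++⁺ (Unique.map⁺ ∷-injectiveʳ (upPaths-unique n (m ℤ.+ + k))) (downPathsFrom-unique n m f (suc k)) disjoint
  where
  disjoint : ∀ {p} → p ∈ map (D k ∷_) (upPaths n (m ℤ.+ + k)) × p ∈ downPathsFrom n m f (suc k) → ⊥
  disjoint (p∈here , p∈rest) with ∈-map⁻ (D k ∷_) p∈here | downPathsFrom-sound n m f (suc k) _ p∈rest
  ... | _ , _ , refl | _ , _ , refl , _ , k<k = ℕP.<-irrefl refl k<k

upPaths-unique zero (+ zero)  = [] ∷ []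
upPaths-unique zero (+ suc _) = []
upPaths-unique zero -[1+ _ ]  = [] ∷ []
upPaths-unique (suc n) h      = Unique.map⁺ ∷-injectiveʳ (admissiblePaths-unique n (ℤ.pred h))

admissiblePaths-unique n h = Unique.++⁺ (upPaths-unique n h) (downPaths-unique n h) disjoint
  where
  disjoint : ∀ {p} → p ∈ upPaths n h × p ∈ downPaths n h → ⊥
  disjoint {p} (p∈up , p∈down) = downPaths-leadingDown n h p p∈down (proj₂ (upPaths-sound n h p p∈up))

downPaths-unique zero    h = []
downPaths-unique (suc n) h = downPathsFrom-unique n (ℤ.suc h) (fuel n (ℤ.suc h)) 0

#up #down : ℕ → ℤ → ℕ
#up n h   = length (upPaths n h)
#down n h = length (downPaths n h)

length≡0 : ∀ {A : Set} (xs : List A) → (∀ x → x ∈ xs → ⊥) → length xs ≡ 0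
length≡0 []      _     = refl
length≡0 (x ∷ _) no∈xs = ⊥-elim (no∈xs x (here refl))

#up-vanishes : ∀ {n h} → + n ℤ.< h → #up n h ≡ 0
#up-vanishes {n} {h} n<h = length≡0 (upPaths n h) λ p p∈ →
  let (len , _ , h≤height) = proj₁ (upPaths-sound n h p p∈)
  in ℤP.<⇒≱ n<h (ℤP.≤-trans h≤height (subst (λ l → height p ℤ.≤ + l) len (height≤length p)))

#up-suc : ∀ n h → #up (suc n) h ≡ #up n (ℤ.pred h) ℕ.+ #down n (ℤ.pred h)
#up-suc n h = trans (length-map (U ∷_) (admissiblePaths n (ℤ.pred h))) (length-++ (upPaths n (ℤ.pred h)))

Σ#up : ℕ → ℤ → ℕ → ℕ
Σ#up n m zero    = 0
Σ#up n m (suc f) = #up n m ℕ.+ Σ#up n (ℤ.suc m) f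

Σ#up-vanishes : ∀ {n m} f → + n ℤ.< m → Σ#up n m f ≡ 0
Σ#up-vanishes zero    n<m = refl
Σ#up-vanishes (suc f) n<m =
  cong₂ ℕ._+_ (#up-vanishes n<m) (Σ#up-vanishes f (ℤP.<-≤-trans n<m (ℤP.i≤suc[i] _)))

Σ#up-saturated : ∀ {n m} f e → + n ℤ.< m ℤ.+ + f → Σ#up n m (f ℕ.+ e) ≡ Σ#up n m f
Σ#up-saturated {m = m} zero e n<m+0 = Σ#up-vanishes e (subst (_ ℤ.<_) (ℤP.+-identityʳ m) n<m+0)
Σ#up-saturated {n} {m} (suc f) e n<m+f =
  cong (#up n m ℕ.+_) (Σ#up-saturated f e (subst (_ ℤ.<_) (i+suc[j]≡suc[i]+j m (+ f)) n<m+f))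

Σ#up-fuel-irrelevant : ∀ {n m} f f′ → + n ℤ.< m ℤ.+ + f → + n ℤ.< m ℤ.+ + f′ → Σ#up n m f ≡ Σ#up n m f′
Σ#up-fuel-irrelevant f f′ sat sat′ with ℕP.≤-total f f′
... | inj₁ f≤f′ with ℕP.m≤n⇒∃[o]m+o≡n f≤f′
...   | e , refl = sym (Σ#up-saturated f e sat)
Σ#up-fuel-irrelevant f f′ sat sat′ | inj₂ f′≤f with ℕP.m≤n⇒∃[o]m+o≡n f′≤f
...   | e , refl = Σ#up-saturated f′ e sat′

length-downPathsFrom : ∀ n m f k → length (downPathsFrom n m f k) ≡ Σ#up n (m ℤ.+ + k) f
length-downPathsFrom n m zero    k = refl
length-downPathsFrom n m (suc f) k = begin
  length (map (D k ∷_) (upPaths n (m ℤ.+ + k)) ++ downPathsFrom n m f (suc k))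
    ≡⟨ length-++ (map (D k ∷_) (upPaths n (m ℤ.+ + k))) ⟩
  length (map (D k ∷_) (upPaths n (m ℤ.+ + k))) ℕ.+ length (downPathsFrom n m f (suc k))
    ≡⟨ cong₂ ℕ._+_ (length-map (D k ∷_) (upPaths n (m ℤ.+ + k))) (length-downPathsFrom n m f (suc k)) ⟩
  #up n (m ℤ.+ + k) ℕ.+ Σ#up n (m ℤ.+ + suc k) f
    ≡⟨ cong (λ m′ → #up n (m ℤ.+ + k) ℕ.+ Σ#up n m′ f) (trans (i+suc[j]≡suc[i]+j m (+ k)) (ℤP.+-assoc (+ 1) m (+ k))) ⟩
  #up n (m ℤ.+ + k) ℕ.+ Σ#up n (ℤ.suc (m ℤ.+ + k)) f
    ∎
  where open ≡-Reasoning

fuel-saturates : ∀ n m → + n ℤ.< m ℤ.+ + fuel n m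
fuel-saturates n (+ a)    = ℤ.+<+ (ℕP.≤-trans (s≤s (ℕP.m≤m+n n a)) (ℕP.m≤n+m (fuel n (+ a)) a))
fuel-saturates n -[1+ a ] = subst (+ n ℤ.<_) (sym (cancel (+ a) (+ n))) (ℤ.+<+ (ℕP.n<1+n n))
  where
  cancel : ∀ a n → ℤ.- (+ 1 ℤ.+ a) ℤ.+ (+ 1 ℤ.+ (n ℤ.+ (+ 1 ℤ.+ a))) ≡ + 1 ℤ.+ n
  cancel = ℤ-RingSolver.solve-∀

-- #tail n m = Σ_{k ≥ 0} #up n (m + k), a finite sum by #up-vanishes.
#tail : ℕ → ℤ → ℕ
#tail n m = Σ#up n m (fuel n m)

#down-suc : ∀ n h → #down (suc n) h ≡ #tail n (ℤ.suc h)
#down-suc n h = trans (length-downPathsFrom n (ℤ.suc h) (fuel n (ℤ.suc h)) 0)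
                      (cong (λ m → Σ#up n m (fuel n (ℤ.suc h))) (ℤP.+-identityʳ (ℤ.suc h)))

#tail-step : ∀ n h → #tail n h ≡ #up n h ℕ.+ #tail n (ℤ.suc h)
#tail-step n h = cong (#up n h ℕ.+_) (Σ#up-fuel-irrelevant (n ℕ.+ ℤ.∣ h ∣) (fuel n (ℤ.suc h))
  (subst (_ ℤ.<_) (i+suc[j]≡suc[i]+j h (+ (n ℕ.+ ℤ.∣ h ∣))) (fuel-saturates n h)) (fuel-saturates n (ℤ.suc h)))

#tail-vanishes : ∀ {n h} → + n ℤ.< h → #tail n h ≡ 0
#tail-vanishes {n} {h} = Σ#up-vanishes (fuel n h)

NoDD-prefix : ∀ p w → NoDD (p ++ w) → NoDD p
NoDD-prefix []              w _  = tt
NoDD-prefix (U ∷ p)         w nd = NoDD-prefix p w nd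
NoDD-prefix (D k ∷ [])      w _  = tt
NoDD-prefix (D k ∷ U ∷ p)   w nd = NoDD-prefix (U ∷ p) w nd

NoDD-++-U : ∀ p w → NoDD p → NoDD (U ∷ w) → NoDD (p ++ U ∷ w)
NoDD-++-U []            w _  nw = nw
NoDD-++-U (U ∷ p)       w nd nw = NoDD-++-U p w nd nw
NoDD-++-U (D k ∷ [])    w _  nw = nw
NoDD-++-U (D k ∷ U ∷ p) w nd nw = NoDD-++-U (U ∷ p) w nd nw

height-++ : ∀ p w → height (p ++ w) ≡ height p ℤ.+ height w
height-++ []      w = sym (ℤP.+-identityˡ (height w))
height-++ (s ∷ p) w = trans (cong (λ t → stepHeight s ℤ.+ t) (height-++ p w)) (sym (ℤP.+-assoc (stepHeight s) (height p) (height w)))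

return-to-axis : ∀ p m → NoDD p → height p ≡ + suc m → IsGDAP (p ++ U ∷ D (suc m) ∷ [])
return-to-axis p m nd height≡ = NoDD-++-U p (D (suc m) ∷ []) nd tt , (begin
  height (p ++ U ∷ D (suc m) ∷ [])              ≡⟨ height-++ p (U ∷ D (suc m) ∷ []) ⟩
  height p ℤ.+ height (U ∷ D (suc m) ∷ [])      ≡⟨ cong (ℤ._+ height (U ∷ D (suc m) ∷ [])) height≡ ⟩
  + suc m ℤ.+ height (U ∷ D (suc m) ∷ [])       ≡⟨ ℤP.n⊖n≡0 (suc m) ⟩
  + 0                                           ∎)
  where open ≡-Reasoning

∈admissiblePaths⇔Counted : ∀ n p → (p ∈ admissiblePaths n (+ 1)) ⇔ Counted n p
∈admissiblePaths⇔Counted n p = mk⇔ to from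
  where
  to : p ∈ admissiblePaths n (+ 1) → Counted n p
  to p∈ with admissiblePaths-sound n (+ 1) p p∈
  ... | len , nd , 1≤height with height p in height≡
  ... | + suc m = len , (U ∷ D (suc m) ∷ [] , return-to-axis p m nd height≡) , ℤ.+<+ (s≤s z≤n)
  to p∈ | len , nd , ℤ.+≤+ () | + zero
  from : Counted n p → p ∈ admissiblePaths n (+ 1)
  from (len , (w , nd , _) , 0<height) =
    admissiblePaths-complete n (+ 1) p (len , NoDD-prefix p w nd , ℤP.i<j⇒suc[i]≤j 0<height)

hasCount : ∀ n → HasCount n (length (admissiblePaths n (+ 1)))
hasCount n = admissiblePaths n (+ 1) , admissiblePaths-unique n (+ 1) , ∈admissiblePaths⇔Counted n , refl

χ≤0 : ℤ → ℚ
χ≤0 (+ zero)  = 1ℚ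
χ≤0 (+ suc _) = 0ℚ
χ≤0 -[1+ _ ]  = 1ℚ

record System (G : Series) : Set where
  field
    Q T        : ℤ → Series
    Q-rec      : ∀ h → Q h ≈ χ≤0 h ·ₛ G + (xs· (Q (ℤ.pred h)) + xs· (xs· (T h)))
    T-rec      : ∀ h → T h ≈ Q h + T (ℤ.suc h)
    T-vanishes : ∀ {n h} → + n ℤ.< h → T h n ≡ 0ℚ

module _ {G : Series} (A B : System G) where
  private
    module A = System A
    module B = System B

  Q-agree : ℕ → Set
  Q-agree n = ∀ h → A.Q h n ≡ B.Q h n

  T-agree : ∀ n → Q-agree n → ∀ h → A.T h n ≡ B.T h n
  T-agree n Q≡ h = by-distance (fuel n h) h (fuel-saturates n h)
    where
    by-distance : ∀ j h → + n ℤ.< h ℤ.+ + j → A.T h n ≡ B.T h n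
    by-distance zero h n<h+0 = trans (A.T-vanishes n<h) (sym (B.T-vanishes n<h))
      where n<h = subst (+ n ℤ.<_) (ℤP.+-identityʳ h) n<h+0
    by-distance (suc j) h n<h+j = begin
      A.T h n                          ≡⟨ A.T-rec h n ⟩
      A.Q h n ℚ.+ A.T (ℤ.suc h) n      ≡⟨ cong₂ ℚ._+_ (Q≡ h) (by-distance j (ℤ.suc h) (subst (+ n ℤ.<_) (i+suc[j]≡suc[i]+j h (+ j)) n<h+j)) ⟩
      B.Q h n ℚ.+ B.T (ℤ.suc h) n      ≡⟨ B.T-rec h n ⟨
      B.T h n                          ∎
      where open ≡-Reasoning

  -- Q h at degree n + 2 is determined by Q at degree n + 1 and T at degree n.
  Q-agree-pair : ∀ n → Q-agree n × Q-agree (suc n)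
  Q-agree-pair zero = Q₀≡ , Q₁≡
    where
    Q₀≡ : Q-agree 0
    Q₀≡ h = trans (A.Q-rec h 0) (sym (B.Q-rec h 0))
    Q₁≡ : Q-agree 1
    Q₁≡ h = trans (A.Q-rec h 1) (trans (cong (λ t → (χ≤0 h ·ₛ G) 1 ℚ.+ (t ℚ.+ 0ℚ)) (Q₀≡ (ℤ.pred h))) (sym (B.Q-rec h 1)))
  Q-agree-pair (suc n) with Q-agree-pair n
  ... | Qₙ≡ , Qₙ₊₁≡ = Qₙ₊₁≡ , Qₙ₊₂≡
    where
    Qₙ₊₂≡ : Q-agree (2 ℕ.+ n)
    Qₙ₊₂≡ h = trans (A.Q-rec h (2 ℕ.+ n))
      (trans (cong₂ (λ s t → (χ≤0 h ·ₛ G) (2 ℕ.+ n) ℚ.+ (s ℚ.+ t)) (Qₙ₊₁≡ (ℤ.pred h)) (T-agree n Qₙ≡ h))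
             (sym (B.Q-rec h (2 ℕ.+ n))))

  System-unique-Q : ∀ h → A.Q h ≈ B.Q h
  System-unique-Q h n = proj₁ (Q-agree-pair n) h

  System-unique-T : ∀ h → A.T h ≈ B.T h
  System-unique-T h n = T-agree n (λ h′ → System-unique-Q h′ n) h

ℕ→ℚ : ℕ → ℚ
ℕ→ℚ n = q (+ n)

ℕ→ℚ-+ : ∀ a b → ℕ→ℚ (a ℕ.+ b) ≡ ℕ→ℚ a ℚ.+ ℕ→ℚ b
ℕ→ℚ-+ a b = ℚP.toℚᵘ-injective (begin
  ℚ.toℚᵘ (ℕ→ℚ (a ℕ.+ b))                       ≈⟨ ℚP.toℚᵘ-fromℚᵘ (ℚᵘ.mkℚᵘ (+ (a ℕ.+ b)) 0) ⟩
  ℚᵘ.mkℚᵘ (+ (a ℕ.+ b)) 0                       ≈⟨ ℚᵘ.*≡* (cong (ℤ._* + 1) (sum-of-fractions (+ a) (+ b))) ⟩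
  ℚᵘ.mkℚᵘ (+ a) 0 ℚᵘ.+ ℚᵘ.mkℚᵘ (+ b) 0          ≈⟨ ℚᵘP.+-cong (ℚP.toℚᵘ-fromℚᵘ (ℚᵘ.mkℚᵘ (+ a) 0)) (ℚP.toℚᵘ-fromℚᵘ (ℚᵘ.mkℚᵘ (+ b) 0)) ⟨
  ℚ.toℚᵘ (ℕ→ℚ a) ℚᵘ.+ ℚ.toℚᵘ (ℕ→ℚ b)          ≈⟨ ℚP.toℚᵘ-homo-+ (ℕ→ℚ a) (ℕ→ℚ b) ⟨
  ℚ.toℚᵘ (ℕ→ℚ a ℚ.+ ℕ→ℚ b)                     ∎)
  where
  open import Relation.Binary.Reasoning.Setoid ℚᵘP.≃-setoid
  sum-of-fractions : ∀ a b → a ℤ.+ b ≡ a ℤ.* + 1 ℤ.+ b ℤ.* + 1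
  sum-of-fractions = ℤ-RingSolver.solve-∀

upSeries tailSeries : ℤ → Series
upSeries h n   = ℕ→ℚ (#up n h)
tailSeries h n = ℕ→ℚ (#tail n h)

no-forcing : ∀ h n x → x ≡ (χ≤0 h ·ₛ 1ₛ) (suc n) ℚ.+ x
no-forcing h n x = sym (trans (cong (ℚ._+ x) (ℚP.*-zeroʳ (χ≤0 h))) (ℚP.+-identityˡ x))

upSeries-rec : ∀ h → upSeries h ≈ χ≤0 h ·ₛ 1ₛ + (xs· (upSeries (ℤ.pred h)) + xs· (xs· (tailSeries h)))
upSeries-rec (+ zero)  zero = refl
upSeries-rec (+ suc _) zero = refl
upSeries-rec -[1+ _ ]  zero = refl
upSeries-rec h (suc zero) = begin
  ℕ→ℚ (#up 1 h)                                    ≡⟨ cong ℕ→ℚ (trans (#up-suc 0 h) (ℕP.+-identityʳ _)) ⟩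
  ℕ→ℚ (#up 0 (ℤ.pred h))                           ≡⟨ ℚP.+-identityʳ _ ⟨
  ℕ→ℚ (#up 0 (ℤ.pred h)) ℚ.+ 0ℚ                    ≡⟨ no-forcing h 0 _ ⟩
  (χ≤0 h ·ₛ 1ₛ) 1 ℚ.+ (ℕ→ℚ (#up 0 (ℤ.pred h)) ℚ.+ 0ℚ) ∎
  where open ≡-Reasoning
upSeries-rec h (suc (suc n)) = begin
  ℕ→ℚ (#up (2 ℕ.+ n) h)                                   ≡⟨ cong ℕ→ℚ (#up-suc (suc n) h) ⟩
  ℕ→ℚ (#up (suc n) (ℤ.pred h) ℕ.+ #down (suc n) (ℤ.pred h)) ≡⟨ cong (λ t → ℕ→ℚ (#up (suc n) (ℤ.pred h) ℕ.+ t)) down≡tail ⟩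
  ℕ→ℚ (#up (suc n) (ℤ.pred h) ℕ.+ #tail n h)              ≡⟨ ℕ→ℚ-+ (#up (suc n) (ℤ.pred h)) (#tail n h) ⟩
  ℕ→ℚ (#up (suc n) (ℤ.pred h)) ℚ.+ ℕ→ℚ (#tail n h)        ≡⟨ no-forcing h (suc n) _ ⟩
  (χ≤0 h ·ₛ 1ₛ) (2 ℕ.+ n) ℚ.+ (ℕ→ℚ (#up (suc n) (ℤ.pred h)) ℚ.+ ℕ→ℚ (#tail n h)) ∎
  where
  open ≡-Reasoning
  down≡tail : #down (suc n) (ℤ.pred h) ≡ #tail n h
  down≡tail = trans (#down-suc n (ℤ.pred h)) (cong (#tail n) (ℤP.suc-pred h))

countSystem : System 1ₛ
countSystem = record
  { Q          = upSeries
  ; T          = tailSeries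
  ; Q-rec      = upSeries-rec
  ; T-rec      = λ h n → trans (cong ℕ→ℚ (#tail-step n h)) (ℕ→ℚ-+ (#up n h) (#tail n (ℤ.suc h)))
  ; T-vanishes = λ n<h → cong ℕ→ℚ (#tail-vanishes n<h)
  }

⊛-xs· : ∀ f g → f * xs· g ≈ xs· (f * g)
⊛-xs· f g n = trans (⊛-comm f (xs· g) n) (trans (xs·-⊛ g f n) (xs·-cong (⊛-comm g f) n))

⊛-·ₛ1ₛ : ∀ f c → f * (c ·ₛ 1ₛ) ≈ c ·ₛ f
⊛-·ₛ1ₛ f c n = trans (⊛-comm f (c ·ₛ 1ₛ) n) (trans (·ₛ-⊛ c 1ₛ f n) (cong (c ℚ.*_) (⊛-identityˡ f n)))

scaleSystem : ∀ K → System 1ₛ → System K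
scaleSystem K S = record
  { Q          = λ h → K * Q h
  ; T          = λ h → K * T h
  ; Q-rec      = λ h → begin
      K * Q h                                                          ≈⟨ *-cong (≈-refl {K}) (Q-rec h) ⟩
      K * (χ≤0 h ·ₛ 1ₛ + (xs· (Q (ℤ.pred h)) + xs· (xs· (T h))))       ≈⟨ distribˡ K _ _ ⟩
      K * (χ≤0 h ·ₛ 1ₛ) + K * (xs· (Q (ℤ.pred h)) + xs· (xs· (T h)))   ≈⟨ +-cong (⊛-·ₛ1ₛ K (χ≤0 h)) (distribˡ K _ _) ⟩
      χ≤0 h ·ₛ K + (K * xs· (Q (ℤ.pred h)) + K * xs· (xs· (T h)))      ≈⟨ +-cong (≈-refl {χ≤0 h ·ₛ K}) (+-cong (⊛-xs· K (Q (ℤ.pred h)))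
                                                                            (≈-trans (⊛-xs· K (xs· (T h))) (xs·-cong (⊛-xs· K (T h))))) ⟩
      χ≤0 h ·ₛ K + (xs· (K * Q (ℤ.pred h)) + xs· (xs· (K * T h)))      ∎
  ; T-rec      = λ h → ≈-trans (*-cong (≈-refl {K}) (T-rec h)) (distribˡ K (Q h) (T (ℤ.suc h)))
  ; T-vanishes = λ {n} {h} n<h → trans (⊛-comm K (T h) n)
      (⊛-vanishes (T h) K n (λ m m≤n → T-vanishes (ℤP.≤-<-trans (ℤ.+≤+ m≤n) n<h)))
  }
  where open System S; open ≈-Reasoning

infixr 8 _^_
_^_ : Series → ℕ → Series
f ^ zero  = 1ₛ
f ^ suc k = f * f ^ k

xs·^-vanishes : ∀ f k m → m ℕ.< k → (xs· f ^ k) m ≡ 0ℚ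
xs·^-vanishes f (suc k) zero    _         = xs·-⊛ f (xs· f ^ k) 0
xs·^-vanishes f (suc k) (suc m) (s≤s m<k) = trans (xs·-⊛ f (xs· f ^ k) (suc m))
  (trans (⊛-comm f (xs· f ^ k) m) (⊛-vanishes (xs· f ^ k) f m (λ i i≤m → xs·^-vanishes f k i (ℕP.≤-<-trans i≤m m<k))))

≈-modulo : ∀ {Z} → Z ≈ 0ₛ → ∀ {L R} c → L ≈ R + c * Z → L ≈ R
≈-modulo {Z} Z≈0 {L} {R} c L≈ = begin
  L             ≈⟨ L≈ ⟩
  R + c * Z     ≈⟨ +-cong (≈-refl {R}) (*-cong (≈-refl {c}) Z≈0) ⟩
  R + c * 0ₛ    ≈⟨ +-cong (≈-refl {R}) (zeroʳ c) ⟩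
  R + 0ₛ        ≈⟨ +-identityʳ R ⟩
  R             ∎
  where open ≈-Reasoning

P : Series → Series
P x = x * x - x - 1ₛ

quadratic M K : Series → Series → Series
quadratic x f = x * (f * f) + P x * f + 1ₛ
M x f = 1ₛ - x * f
K x f = (1ₛ - x * (f * f)) * M x f

module ClosedForm (F : Series) (quadratic≈0 : quadratic X F ≈ 0ₛ) where
  open ≈-Reasoning

  -- Q⁻ j and T⁻ j are the values at height -j.
  Q⁻ T⁻ : ℕ → Series
  Q⁻ j       = M X F * F ^ suc j
  T⁻ zero    = F * xs· F ^ 0
  T⁻ (suc j) = Q⁻ (suc j) + T⁻ j

  Q T : ℤ → Series
  Q (+ k)    = (M X F * F) * xs· F ^ k
  Q -[1+ m ] = Q⁻ (suc m)
  T (+ k)    = F * xs· F ^ k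
  T -[1+ m ] = T⁻ (suc m)

  shifts≈ : ∀ A B → xs· A + xs· (xs· B) ≈ X * A + X * (X * B)
  shifts≈ A B = +-cong (xs·≈X* A) (≈-trans (xs·≈X* (xs· B)) (*-cong (≈-refl {X}) (xs·≈X* B)))

  Q⁻-rec : ∀ j → Q⁻ j ≈ K X F + (X * Q⁻ (suc j) + X * (X * T⁻ j))
  Q⁻-rec zero    = ≈-modulo quadratic≈0 (const (ℚ.- 1ℚ)) (identity X F)
    where
    identity : ∀ x f → M x f * (f * 1ₛ)
      ≈ K x f + (x * (M x f * (f * (f * 1ₛ))) + x * (x * (f * 1ₛ))) + const (ℚ.- 1ℚ) * quadratic x f
    identity = solve 2 (λ x f → (con 1ℚ :- x :* f) :* (f :* con 1ℚ) :=
      (con 1ℚ :- x :* (f :* f)) :* (con 1ℚ :- x :* f)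
        :+ (x :* ((con 1ℚ :- x :* f) :* (f :* (f :* con 1ℚ))) :+ x :* (x :* (f :* con 1ℚ)))
        :+ con (ℚ.- 1ℚ) :* (x :* (f :* f) :+ (x :* x :- x :- con 1ℚ) :* f :+ con 1ℚ)) (λ _ → refl)
  Q⁻-rec (suc j) = begin
    Q⁻ (suc j)                                                      ≈⟨ ≈-modulo quadratic≈0 (- Q⁻ j) (identity X F (F ^ suc j) (T⁻ j)) ⟩
    K X F + (X * Q⁻ (2 ℕ.+ j) + X * (X * T⁻ (suc j))) + (Q⁻ j - (K X F + (X * Q⁻ (suc j) + X * (X * T⁻ j))))
                                                                    ≈⟨ +-cong (≈-refl {K X F + (X * Q⁻ (2 ℕ.+ j) + X * (X * T⁻ (suc j)))})
                                                                              (x≈y⇒x∙y⁻¹≈ε (Q⁻-rec j)) ⟩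
    K X F + (X * Q⁻ (2 ℕ.+ j) + X * (X * T⁻ (suc j))) + 0ₛ          ≈⟨ +-identityʳ _ ⟩
    K X F + (X * Q⁻ (2 ℕ.+ j) + X * (X * T⁻ (suc j)))               ∎
    where
    -- the defect of the recurrence at depth j + 1 is that at depth j plus M F^(j+1) · quadratic
    identity : ∀ x f p t → M x f * (f * p)
      ≈ K x f + (x * (M x f * (f * (f * p))) + x * (x * (M x f * (f * p) + t)))
        + (M x f * p - (K x f + (x * (M x f * (f * p)) + x * (x * t))))
        + (- (M x f * p)) * quadratic x f
    identity = solve 4 (λ x f p t → (con 1ℚ :- x :* f) :* (f :* p) :=
      (con 1ℚ :- x :* (f :* f)) :* (con 1ℚ :- x :* f)
        :+ (x :* ((con 1ℚ :- x :* f) :* (f :* (f :* p))) :+ x :* (x :* ((con 1ℚ :- x :* f) :* (f :* p) :+ t)))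
        :+ ((con 1ℚ :- x :* f) :* p :- ((con 1ℚ :- x :* (f :* f)) :* (con 1ℚ :- x :* f)
                                         :+ (x :* ((con 1ℚ :- x :* f) :* (f :* p)) :+ x :* (x :* t))))
        :+ (:- ((con 1ℚ :- x :* f) :* p)) :* (x :* (f :* f) :+ (x :* x :- x :- con 1ℚ) :* f :+ con 1ℚ)) (λ _ → refl)

  Q-rec : ∀ h → Q h ≈ χ≤0 h ·ₛ K X F + (xs· (Q (ℤ.pred h)) + xs· (xs· (T h)))
  Q-rec (+ zero) = begin
    (M X F * F) * 1ₛ                                         ≈⟨ solve 2 (λ m f → (m :* f) :* con 1ℚ := m :* (f :* con 1ℚ)) (λ _ → refl) (M X F) F ⟩
    Q⁻ 0                                                     ≈⟨ Q⁻-rec 0 ⟩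
    K X F + (X * Q⁻ 1 + X * (X * T⁻ 0))                      ≈⟨ +-cong (·ₛ-identityˡ (K X F)) (shifts≈ (Q⁻ 1) (T⁻ 0)) ⟨
    1ℚ ·ₛ K X F + (xs· (Q⁻ 1) + xs· (xs· (T⁻ 0)))            ∎
  Q-rec (+ suc k) = begin
    (M X F * F) * (xs· F * Y)                                ≈⟨ *-cong (≈-refl {M X F * F}) xFY≈ ⟩
    (M X F * F) * (X * F * Y)                                ≈⟨ ≈-modulo quadratic≈0 (- (X * F * Y)) (identity X F Y) ⟩
    X * ((M X F * F) * Y) + X * (X * (F * (X * F * Y)))      ≈⟨ +-cong (≈-refl {X * ((M X F * F) * Y)})
                                                                       (*-cong (≈-refl {X}) (*-cong (≈-refl {X}) (*-cong (≈-refl {F}) xFY≈))) ⟨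
    X * Q (+ k) + X * (X * T (+ suc k))                      ≈⟨ shifts≈ (Q (+ k)) (T (+ suc k)) ⟨
    xs· (Q (+ k)) + xs· (xs· (T (+ suc k)))                  ≈⟨ +-identityˡ _ ⟨
    0ₛ + (xs· (Q (+ k)) + xs· (xs· (T (+ suc k))))           ≈⟨ +-cong (·ₛ-zeroˡ (K X F)) ≈-refl ⟨
    0ℚ ·ₛ K X F + (xs· (Q (+ k)) + xs· (xs· (T (+ suc k))))  ∎
    where
    Y = xs· F ^ k
    xFY≈ : xs· F * Y ≈ X * F * Y
    xFY≈ = *-cong (xs·≈X* F) (≈-refl {Y})
    identity : ∀ x f y → (M x f * f) * (x * f * y)
      ≈ x * ((M x f * f) * y) + x * (x * (f * (x * f * y))) + (- (x * f * y)) * quadratic x f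
    identity = solve 3 (λ x f y → ((con 1ℚ :- x :* f) :* f) :* (x :* f :* y) :=
      x :* (((con 1ℚ :- x :* f) :* f) :* y) :+ x :* (x :* (f :* (x :* f :* y)))
        :+ (:- (x :* f :* y)) :* (x :* (f :* f) :+ (x :* x :- x :- con 1ℚ) :* f :+ con 1ℚ)) (λ _ → refl)
  Q-rec -[1+ m ] = begin
    Q⁻ (suc m)                                                        ≈⟨ Q⁻-rec (suc m) ⟩
    K X F + (X * Q⁻ (2 ℕ.+ m) + X * (X * T⁻ (suc m)))                 ≈⟨ +-cong (·ₛ-identityˡ (K X F)) (shifts≈ (Q⁻ (2 ℕ.+ m)) (T⁻ (suc m))) ⟨
    1ℚ ·ₛ K X F + (xs· (Q⁻ (2 ℕ.+ m)) + xs· (xs· (T⁻ (suc m))))       ∎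

  T-rec : ∀ h → T h ≈ Q h + T (ℤ.suc h)
  T-rec (+ k) = begin
    F * Y                                     ≈⟨ solve 3 (λ x f y → f :* y := ((con 1ℚ :- x :* f) :* f) :* y :+ f :* (x :* f :* y))
                                                   (λ _ → refl) X F Y ⟩
    (M X F * F) * Y + F * (X * F * Y)          ≈⟨ +-cong (≈-refl {(M X F * F) * Y}) (*-cong (≈-refl {F}) (*-cong (xs·≈X* F) (≈-refl {Y}))) ⟨
    (M X F * F) * Y + F * (xs· F * Y)          ∎
    where Y = xs· F ^ k
  T-rec -[1+ zero ]  = ≈-refl
  T-rec -[1+ suc m ] = ≈-refl

  T-vanishes : ∀ {n h} → + n ℤ.< h → T h n ≡ 0ℚ
  T-vanishes {n} {+ k} (ℤ.+<+ n<k) = trans (⊛-comm F (xs· F ^ k) n)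
    (⊛-vanishes (xs· F ^ k) F n (λ m m≤n → xs·^-vanishes F k m (ℕP.≤-<-trans m≤n n<k)))

  closedSystem : System (K X F)
  closedSystem = record { Q = Q ; T = T ; Q-rec = Q-rec ; T-rec = T-rec ; T-vanishes = T-vanishes }

K-head : ∀ f → K X f 0 ≡ 1ℚ
K-head f = trans (⊛-head (1ₛ - X * (f * f)) (M X f)) (cong₂ ℚ._*_ (1-X*-head (f * f)) (1-X*-head f))
  where
  1-X*-head : ∀ g → (1ₛ - X * g) 0 ≡ 1ℚ
  1-X*-head g = cong (λ t → 1ℚ ℚ.+ ℚ.- t) (trans (⊛-head X g) (ℚP.*-zeroˡ (g 0)))

hornerForm : List ℚ → Series
hornerForm []           = 0ₛ
hornerForm (c ∷ [])     = const c
hornerForm (c ∷ d ∷ cs) = const c + X * hornerForm (d ∷ cs)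

poly≈hornerForm : ∀ cs → poly cs ≈ hornerForm cs
poly≈hornerForm []           _ = refl
poly≈hornerForm (c ∷ [])     _ = refl
poly≈hornerForm (c ∷ d ∷ cs)         =
  ≈-trans split (+-cong (≈-refl {const c}) (≈-trans (xs·≈X* _) (*-cong (≈-refl {X}) (poly≈hornerForm (d ∷ cs)))))
  where
  split : poly (c ∷ d ∷ cs) ≈ const c + xs· (poly (d ∷ cs))
  split zero    = sym (ℚP.+-identityʳ c)
  split (suc n) = sym (ℚP.+-identityˡ (poly (d ∷ cs) n))

Pquad≈P : Pquad ≈ P X
Pquad≈P = ≈-trans (poly≈hornerForm (q (ℤ.- (+ 1)) ∷ q (ℤ.- (+ 1)) ∷ q (+ 1) ∷ [])) (expand X)
  where
  expand : ∀ x → const (q (ℤ.- (+ 1))) + x * (const (q (ℤ.- (+ 1))) + x * const (q (+ 1))) ≈ P x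
  expand = solve 1 (λ x → con (q (ℤ.- (+ 1))) :+ x :* (con (q (ℤ.- (+ 1))) :+ x :* con (q (+ 1)))
                          := x :* x :- x :- con 1ℚ) (λ _ → refl)

Pdisc≈P²-4X : Pdisc ≈ P X * P X - const (q (+ 4)) * X
Pdisc≈P²-4X = ≈-trans (poly≈hornerForm (q (+ 1) ∷ q (ℤ.- (+ 2)) ∷ q (ℤ.- (+ 1)) ∷ q (ℤ.- (+ 2)) ∷ q (+ 1) ∷ [])) (expand X)
  where
  expand : ∀ x → const (q (+ 1)) + x * (const (q (ℤ.- (+ 2))) + x * (const (q (ℤ.- (+ 1)))
                   + x * (const (q (ℤ.- (+ 2))) + x * const (q (+ 1))))) ≈ P x * P x - const (q (+ 4)) * x
  expand = solve 1 (λ x → con (q (+ 1)) :+ x :* (con (q (ℤ.- (+ 2))) :+ x :* (con (q (ℤ.- (+ 1)))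
                             :+ x :* (con (q (ℤ.- (+ 2))) :+ x :* con (q (+ 1)))))
                          := (x :* x :- x :- con 1ℚ) :* (x :* x :- x :- con 1ℚ) :- con (q (+ 4)) :* x) (λ _ → refl)

sqrtDisc : Series → Series → Series
sqrtDisc x f = - P x - const (q (+ 2)) * (x * f)

x*quadratic≈ : ∀ x f → x * quadratic x f ≈ const (ℚ.½ ℚ.* ℚ.½) * (sqrtDisc x f * sqrtDisc x f - (P x * P x - const (q (+ 4)) * x))
x*quadratic≈ = solve 2 (λ x f → x :* (x :* (f :* f) :+ (x :* x :- x :- con 1ℚ) :* f :+ con 1ℚ) :=
  con (ℚ.½ ℚ.* ℚ.½) :* ((:- (x :* x :- x :- con 1ℚ) :- con (q (+ 2)) :* (x :* f)) :* (:- (x :* x :- x :- con 1ℚ) :- con (q (+ 2)) :* (x :* f))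
                       :- ((x :* x :- x :- con 1ℚ) :* (x :* x :- x :- con 1ℚ) :- con (q (+ 4)) :* x))) (λ _ → refl)

X*-cancel : ∀ {f} → X * f ≈ 0ₛ → f ≈ 0ₛ
X*-cancel {f} Xf≈0 n = trans (xs·≈X* f (suc n)) (Xf≈0 (suc n))

-- F = -(Pquad + S) / (2 x); the division by x is exact since Pquad + S has constant term -1 + 1 = 0.
root : Series → Series
root S n = ℚ.½ ℚ.* ℚ.- (Pquad (suc n) ℚ.+ S (suc n))

module _ (S : Series) (S-sqrt : IsSqrtDisc S) where
  private
    F = root S
    S₀≡1 = proj₁ S-sqrt

  S≈sqrtDisc : S ≈ sqrtDisc X F
  S≈sqrtDisc = ≈-trans pointwise (+-cong (-‿cong Pquad≈P) (-‿cong (*-cong (≈-refl {const (q (+ 2))}) (xs·≈X* F))))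
    where
    pointwise : S ≈ - Pquad - const (q (+ 2)) * xs· F
    pointwise zero    = trans S₀≡1 (cong (λ t → ℚ.- Pquad 0 ℚ.+ ℚ.- t) (sym (const-⊛ (q (+ 2)) (xs· F) 0)))
    pointwise (suc n) = sym (begin
      ℚ.- p ℚ.+ ℚ.- (const (q (+ 2)) * xs· F) (suc n)   ≡⟨ cong (λ t → ℚ.- p ℚ.+ ℚ.- t) (const-⊛ (q (+ 2)) (xs· F) (suc n)) ⟩
      ℚ.- p ℚ.+ ℚ.- (q (+ 2) ℚ.* (ℚ.½ ℚ.* ℚ.- (p ℚ.+ s)))  ≡⟨ cong (λ t → ℚ.- p ℚ.+ ℚ.- t) (ℚP.*-assoc (q (+ 2)) ℚ.½ (ℚ.- (p ℚ.+ s))) ⟨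
      ℚ.- p ℚ.+ ℚ.- (1ℚ ℚ.* ℚ.- (p ℚ.+ s))               ≡⟨ cancel p s ⟩
      s                                                 ∎)
      where
      open ≡-Reasoning
      p = Pquad (suc n)
      s = S (suc n)
      cancel : ∀ p s → ℚ.- p ℚ.+ ℚ.- (1ℚ ℚ.* ℚ.- (p ℚ.+ s)) ≡ s
      cancel = RingSolver.solve-∀ ℚ-ring

  root-quadratic : quadratic X F ≈ 0ₛ
  root-quadratic = X*-cancel (begin
    X * quadratic X F                                                  ≈⟨ x*quadratic≈ X F ⟩
    const ¼ * (sqrtDisc X F * sqrtDisc X F - (P X * P X - const (q (+ 4)) * X))
                                                                       ≈⟨ *-cong (≈-refl {const ¼}) (+-cong (*-cong S≈sqrtDisc S≈sqrtDisc) (-‿cong Pdisc≈P²-4X)) ⟨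
    const ¼ * (S * S - Pdisc)                                          ≈⟨ *-cong (≈-refl {const ¼}) (x≈y⇒x∙y⁻¹≈ε (proj₂ S-sqrt)) ⟩
    const ¼ * 0ₛ                                                       ≈⟨ zeroʳ (const ¼) ⟩
    0ₛ                                                                 ∎)
    where
    open ≈-Reasoning
    ¼ = ℚ.½ ℚ.* ℚ.½

count : ℕ → ℕ
count n = length (admissiblePaths n (+ 1))

count≈Q₁+xT₂ : fromℕs count ≈ upSeries (+ 1) + xs· (tailSeries (+ 2))
count≈Q₁+xT₂ n = trans (cong ℕ→ℚ (length-++ (upPaths n (+ 1)))) (trans (ℕ→ℚ-+ (#up n (+ 1)) (#down n (+ 1)))
                                                                 (cong (ℕ→ℚ (#up n (+ 1)) ℚ.+_) (down n)))
  where
  down : ∀ n → ℕ→ℚ (#down n (+ 1)) ≡ xs· (tailSeries (+ 2)) n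
  down zero    = refl
  down (suc n) = cong ℕ→ℚ (#down-suc n (+ 1))

-- Q₁ + x T₂ of the closed form is (M F)(x F) + x F (x F)², so this is 4 x S (Q₁ + x T₂) = K (P + S)².
answer-identity : ∀ x f → (const (q (+ 4)) * (x * sqrtDisc x f)) * ((M x f * f) * (x * f * 1ₛ) + x * (f * (x * f * (x * f * 1ₛ))))
  ≈ K x f * ((P x + sqrtDisc x f) * (P x + sqrtDisc x f)) + (const (q (+ 4)) * x * x * f * f * (x - x * x - x * f)) * quadratic x f
answer-identity = solve 2 (λ x f →
  (con (q (+ 4)) :* (x :* (:- (x :* x :- x :- con 1ℚ) :- con (q (+ 2)) :* (x :* f))))
    :* (((con 1ℚ :- x :* f) :* f) :* (x :* f :* con 1ℚ) :+ x :* (f :* (x :* f :* (x :* f :* con 1ℚ))))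
  := (con 1ℚ :- x :* (f :* f)) :* (con 1ℚ :- x :* f)
       :* (((x :* x :- x :- con 1ℚ) :+ (:- (x :* x :- x :- con 1ℚ) :- con (q (+ 2)) :* (x :* f)))
           :* ((x :* x :- x :- con 1ℚ) :+ (:- (x :* x :- x :- con 1ℚ) :- con (q (+ 2)) :* (x :* f))))
     :+ (con (q (+ 4)) :* x :* x :* f :* f :* (x :- x :* x :- x :* f))
        :* (x :* (f :* f) :+ (x :* x :- x :- con 1ℚ) :* f :+ con 1ℚ)) (λ _ → refl)

module _ (S : Series) (S-sqrt : IsSqrtDisc S) where
  private
    F = root S
    open ClosedForm F (root-quadratic S S-sqrt)

  K*count≈ : K X F * fromℕs count ≈ Q (+ 1) + xs· (T (+ 2))
  K*count≈ = begin
    K X F * fromℕs count                                        ≈⟨ *-cong (≈-refl {K X F}) count≈Q₁+xT₂ ⟩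
    K X F * (upSeries (+ 1) + xs· (tailSeries (+ 2)))           ≈⟨ distribˡ (K X F) (upSeries (+ 1)) (xs· (tailSeries (+ 2))) ⟩
    K X F * upSeries (+ 1) + K X F * xs· (tailSeries (+ 2))     ≈⟨ +-cong (≈-refl {K X F * upSeries (+ 1)}) (⊛-xs· (K X F) (tailSeries (+ 2))) ⟩
    K X F * upSeries (+ 1) + xs· (K X F * tailSeries (+ 2))     ≈⟨ +-cong (System-unique-Q scaled closedSystem (+ 1))
                                                                          (xs·-cong (System-unique-T scaled closedSystem (+ 2))) ⟩
    Q (+ 1) + xs· (T (+ 2))                                     ∎
    where
    open ≈-Reasoning
    scaled = scaleSystem (K X F) countSystem

  generatingFunction : Denom S * fromℕs count ≈ Numer S
  generatingFunction = ⊛-cancelˡ {K X F} (K-head F) (Denom S * fromℕs count) (Numer S) (begin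
    K X F * (Denom S * fromℕs count)                   ≈⟨ solve 3 (λ k d a → k :* (d :* a) := d :* (k :* a)) (λ _ → refl) (K X F) (Denom S) (fromℕs count) ⟩
    Denom S * (K X F * fromℕs count)                   ≈⟨ *-cong (≈-refl {Denom S}) K*count≈ ⟩
    Denom S * (Q (+ 1) + xs· (T (+ 2)))                ≈⟨ *-cong (*-cong (≈-refl {const (q (+ 4))}) (≈-trans (xs·≈X* S) (*-cong (≈-refl {X}) S≈))) closed≈ ⟩
    (const (q (+ 4)) * (X * sqrtDisc X F)) * closed    ≈⟨ ≈-modulo (root-quadratic S S-sqrt) (const (q (+ 4)) * X * X * F * F * (X - X * X - X * F)) (answer-identity X F) ⟩
    K X F * ((P X + sqrtDisc X F) * (P X + sqrtDisc X F)) ≈⟨ *-cong (≈-refl {K X F}) (*-cong (+-cong Pquad≈P S≈) (+-cong Pquad≈P S≈)) ⟨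
    K X F * Numer S                                    ∎)
    where
    open ≈-Reasoning
    S≈ = S≈sqrtDisc S S-sqrt
    closed = (M X F * F) * (X * F * 1ₛ) + X * (F * (X * F * (X * F * 1ₛ)))
    xF≈ : xs· F ≈ X * F
    xF≈ = xs·≈X* F
    closed≈ : Q (+ 1) + xs· (T (+ 2)) ≈ closed
    closed≈ = +-cong (*-cong (≈-refl {M X F * F}) (*-cong xF≈ (≈-refl {1ₛ})))
                     (≈-trans (xs·≈X* (T (+ 2))) (*-cong (≈-refl {X}) (*-cong (≈-refl {F}) (*-cong xF≈ (*-cong xF≈ (≈-refl {1ₛ}))))))

theorem2 : ∃[ a ] ((∀ n → HasCount n (a n))
             × (∀ S → IsSqrtDisc S → ∀ n → (Denom S ⊛ fromℕs a) n ≡ Numer S n))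
theorem2 = count , hasCount , generatingFunction
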